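{- Let $p$ be a prime, $\ell\geq 1$, and let $G=(V,E)$ be a connected graph with edge-labeling $\alpha:E\to\{\text{ideals of }\mathbb{Z}/p^\ell\mathbb{Z}\}$. For $1\leq\beta\leq\ell$ let $\rho_\beta:\mathbb{Z}/p^\ell\mathbb{Z}\to\mathbb{Z}/p^\beta\mathbb{Z}$ be the quotient map and $\alpha_\beta(uv)=\rho_\beta(\alpha(uv))$ (so $\alpha_\ell=\alpha$). Let $\mathbf{p}$ be a spline in $[\mathbb{Z}/p^\beta\mathbb{Z}]_{G,\alpha_\beta}$ and let $\bar{\mathbf{p}}\in(\mathbb{Z}/p^\ell\mathbb{Z})^{|V|}$ be the vertex-labeling such that, for each $v\in V$, $\mathbf{p}_v$ and $\bar{\mathbf{p}}_v$ have the same minimal nonnegative coset representative in $\mathbb{Z}$. Then $\bar{\mathbf{p}}$ is a spline in $[\mathbb{Z}/p^\ell\mathbb{Z}]_{G,\alpha_\ell}$.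
   Context: For a commutative ring $R$, a finite connected graph $G=(V,E)$ and an edge-labeling $\alpha$ assigning to each edge an ideal of $R$, a spline on $(G,\alpha)$ is a vertex-labeling $\mathbf{f}\in R^{|V|}$ with $\mathbf{f}_u-\mathbf{f}_v\in\alpha(uv)$ for every edge $uv$; the set of splines is denoted $R_{G,\alpha}$. -}

module Defs where

open import Level using (0ℓ)
open import Data.Nat using (ℕ; zero; suc; _+_; _*_; _∸_; _^_; NonZero)
open import Data.Nat.Properties using (m^n≢0)
open import Data.Nat.DivMod using (_mod_)
open import Data.Nat.Primality using (Prime; prime⇒nonZero)
open import Data.Fin using (Fin; toℕ)
open import Data.List using (List; length; lookup)
open import Data.Product using (_×_; _,_; ∃; proj₁; proj₂)
open import Data.Sum using (_⊎_)
open import Relation.Binary.PropositionalEquality using (_≡_)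

-- The ring ℤ/nℤ, with carrier Fin n (element = its minimal nonnegative
-- coset representative), operations computed modulo n.

module _ (n : ℕ) .{{_ : NonZero n}} where

  0ₘ : Fin n
  0ₘ = 0 mod n

  _+ₘ_ : Fin n → Fin n → Fin n
  a +ₘ b = (toℕ a + toℕ b) mod n

  _*ₘ_ : Fin n → Fin n → Fin n
  a *ₘ b = (toℕ a * toℕ b) mod n

  _-ₘ_ : Fin n → Fin n → Fin n
  a -ₘ b = (toℕ a + (n ∸ toℕ b)) mod n

  record Ideal : Set₁ where
    field
      mem   : Fin n → Set
      0∈    : mem 0ₘ
      +-closed : ∀ {a b} → mem a → mem b → mem (a +ₘ b)
      *-closed : ∀ r {a} → mem a → mem (r *ₘ a)

-- quotient map ℤ/nℤ → ℤ/mℤ (for m ∣ n): reduce the representative mod m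
reduce : ∀ {n} (m : ℕ) .{{_ : NonZero m}} → Fin n → Fin m
reduce m x = toℕ x mod m

nz : ∀ {p} → Prime p → (k : ℕ) → NonZero (p ^ k)
nz {p} pr k = m^n≢0 p k {{prime⇒nonZero pr}}

-- Finite graphs: vertices Fin (verts G), edges a finite list of
-- (unordered) pairs of vertices.

record Graph : Set where
  field
    verts : ℕ
    edges : List (Fin verts × Fin verts)

open Graph public

Edge : Graph → Set
Edge G = Fin (length (edges G))

src tgt : (G : Graph) → Edge G → Fin (verts G)
src G e = proj₁ (lookup (edges G) e)
tgt G e = proj₂ (lookup (edges G) e)

Adjacent : (G : Graph) → Fin (verts G) → Fin (verts G) → Set
Adjacent G u v = ∃ λ (e : Edge G) → (src G e ≡ u × tgt G e ≡ v) ⊎ (src G e ≡ v × tgt G e ≡ u)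

data Walk (G : Graph) : Fin (verts G) → Fin (verts G) → Set where
  here : ∀ {u} → Walk G u u
  step : ∀ {u v w} → Adjacent G u v → Walk G v w → Walk G u w

Connected : Graph → Set
Connected G = ∀ u v → Walk G u v

IsSpline : (G : Graph) (n : ℕ) .{{_ : NonZero n}} →
           (Edge G → Fin n → Set) → (Fin (verts G) → Fin n) → Set
IsSpline G n α f = ∀ (e : Edge G) → α e (_-ₘ_ n (f (src G e)) (f (tgt G e)))

imageLabel : (G : Graph) (n m : ℕ) .{{_ : NonZero n}} .{{_ : NonZero m}} →
             (Edge G → Ideal n) → Edge G → Fin m → Set
imageLabel G n m α e y = ∃ λ (x : Fin n) → Ideal.mem (α e) x × reduce m x ≡ y

module Submission where

-- Write n = p^ℓ and M = p^β, and fix an edge uv with labels a = P_u and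
-- b = P_v (both < M).  The spline condition over ℤ/M provides some x in
-- the ideal I = α(uv) with x ≡ a - b (mod M); we must show that the lifted
-- difference a - b (mod n) lies in I.  The proof uses three facts:
--
--  * an ideal of ℤ/n containing x contains every multiple of gcd(x, n)
--    (Bézout's identity, read modulo n);
--  * the divisors of a prime power form a chain, so g = gcd(x, n), which
--    divides n = p^ℓ, either divides M or is divisible by M;
--  * in both cases g divides the representative a + (n - b) of a - b in
--    ℤ/n: if g ∣ M this follows from x ≡ a - b (mod M), and if M ∣ g then
--    a ≡ b (mod M), hence a = b and the lifted difference is 0.

open import Defs
open import Data.Nat using (ℕ; zero; suc; _+_; _*_; _∸_; _≤_; _<_; _^_; _%_; NonZero; >-nonZero⁻¹)
open import Data.Nat.Properties
open import Data.Nat.Divisibility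
open import Data.Nat.DivMod
open import Data.Nat.GCD using (gcd; gcd-GCD; gcd[m,n]∣m; gcd[m,n]∣n; module Bézout)
open import Data.Nat.Coprimality using (Coprime; coprime-divisor)
open import Data.Nat.Primality using (Prime; prime⇒nonZero; prime⇒irreducible)
open import Data.Fin using (Fin; toℕ)
open import Data.Fin.Properties using (toℕ-injective; toℕ-fromℕ<; toℕ<n)
open import Data.Product using (∃; _,_)
open import Data.Sum using (_⊎_; inj₁; inj₂; [_,_])
open import Relation.Nullary using (¬_; yes; no; contradiction)
open import Relation.Binary.PropositionalEquality
  using (_≡_; refl; sym; trans; cong; cong₂; subst; module ≡-Reasoning)

open ≡-Reasoning

toℕ-mod : ∀ m n .{{_ : NonZero n}} → toℕ (m mod n) ≡ m % n
toℕ-mod m n = toℕ-fromℕ< _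

mod-cong : ∀ {m k} n .{{_ : NonZero n}} → m % n ≡ k % n → m mod n ≡ k mod n
mod-cong {m} {k} n eq = toℕ-injective (begin
  toℕ (m mod n) ≡⟨ toℕ-mod m n ⟩
  m % n         ≡⟨ eq ⟩
  k % n         ≡⟨ toℕ-mod k n ⟨
  toℕ (k mod n) ∎)

toℕ-mod-cancel : ∀ {n} .{{_ : NonZero n}} (x : Fin n) → toℕ x mod n ≡ x
toℕ-mod-cancel {n} x = toℕ-injective (trans (toℕ-mod (toℕ x) n) (m<n⇒m%n≡m (toℕ<n x)))

coprime-to-prime : ∀ {p d} → Prime p → ¬ (p ∣ d) → Coprime d p
coprime-to-prime pr p∤d (i∣d , i∣p) with prime⇒irreducible pr i∣p
... | inj₁ i≡1 = i≡1
... | inj₂ refl = contradiction i∣d p∤d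

-- Every divisor d of p^ℓ is comparable with each power p^β: strip a factor
-- p from d and from both powers as long as p ∣ d, otherwise d is coprime
-- to p and already divides the smaller power p^(ℓ-1).
prime-power-divisors-chain : ∀ {p} → Prime p → ∀ ℓ β {d} →
                             d ∣ p ^ ℓ → d ∣ p ^ β ⊎ p ^ β ∣ d
prime-power-divisors-chain pr zero β d∣1 =
  inj₁ (subst (_∣ _) (sym (∣1⇒≡1 d∣1)) (1∣ _))
prime-power-divisors-chain {p} pr (suc ℓ) β {d} d∣p^1+ℓ with p ∣? d
... | no p∤d =
  prime-power-divisors-chain pr ℓ β (coprime-divisor (coprime-to-prime pr p∤d) d∣p^1+ℓ)
... | yes (divides q d≡q*p) with β
...   | zero = inj₂ (1∣ d)
...   | suc β′ =
  [ (λ q∣p^β′ → inj₁ (subst (_∣ p ^ suc β′) (sym d≡p*q) (*-monoʳ-∣ p q∣p^β′)))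
  , (λ p^β′∣q → inj₂ (subst (p ^ suc β′ ∣_) (sym d≡p*q) (*-monoʳ-∣ p p^β′∣q)))
  ] (prime-power-divisors-chain pr ℓ β′ q∣p^ℓ)
  where
    instance
      p≢0 : NonZero p
      p≢0 = prime⇒nonZero pr
    d≡p*q : d ≡ p * q
    d≡p*q = trans d≡q*p (*-comm q p)
    q∣p^ℓ : q ∣ p ^ ℓ
    q∣p^ℓ = *-cancelˡ-∣ p (subst (_∣ p ^ suc ℓ) d≡p*q d∣p^1+ℓ)

gcd-as-multiple : ∀ x n .{{_ : NonZero n}} → ∃ λ r → (r * x) % n ≡ gcd x n % n
gcd-as-multiple x n with Bézout.identity (gcd-GCD x n)
... | Bézout.+- s y g+yn≡sx = s , (begin
  (s * x) % n         ≡⟨ cong (_% n) g+yn≡sx ⟨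
  (g + y * n) % n     ≡⟨ [m+kn]%n≡m%n g y n ⟩
  g % n               ∎)
  where g = gcd x n
-- Here g ≡ -s·x, so take r = (n - 1)·s ≡ -s.
... | Bézout.-+ s y g+sx≡yn = (n ∸ 1) * s , (begin
  (r * x) % n               ≡⟨ [m+kn]%n≡m%n (r * x) y n ⟨
  (r * x + y * n) % n       ≡⟨ cong (λ t → (r * x + t) % n) g+sx≡yn ⟨
  (r * x + (g + s * x)) % n ≡⟨ cong (_% n) (shuffle (r * x) g (s * x)) ⟩
  (g + (r * x + s * x)) % n ≡⟨ cong (λ t → (g + t) % n) r*x+s*x≡sx*n ⟩
  (g + s * x * n) % n       ≡⟨ [m+kn]%n≡m%n g (s * x) n ⟩
  g % n                     ∎)
  where
    g = gcd x n
    r = (n ∸ 1) * s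
    shuffle : ∀ a b c → a + (b + c) ≡ b + (a + c)
    shuffle a b c = trans (sym (+-assoc a b c))
                     (trans (cong (_+ c) (+-comm a b)) (+-assoc b a c))
    r*x+s*x≡sx*n : r * x + s * x ≡ s * x * n
    r*x+s*x≡sx*n = begin
      (n ∸ 1) * s * x + s * x ≡⟨ cong (_+ s * x) (*-assoc (n ∸ 1) s x) ⟩
      (n ∸ 1) * (s * x) + s * x ≡⟨ cong ((n ∸ 1) * (s * x) +_) (*-identityˡ (s * x)) ⟨
      (n ∸ 1) * (s * x) + 1 * (s * x) ≡⟨ *-distribʳ-+ (s * x) (n ∸ 1) 1 ⟨
      (n ∸ 1 + 1) * (s * x) ≡⟨ cong (_* (s * x)) (m∸n+n≡m (>-nonZero⁻¹ n)) ⟩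
      n * (s * x)           ≡⟨ *-comm n (s * x) ⟩
      s * x * n             ∎

-- An ideal of ℤ/n containing x contains every multiple of gcd(x, n);
-- this is what replaces "ideals of ℤ/n are principal" in the argument.
module IdealMultiples (n : ℕ) .{{_ : NonZero n}} (I : Ideal n) where
  open Ideal I

  scale-mem : ∀ k m → mem (m mod n) → mem ((k * m) mod n)
  scale-mem k m m∈I = subst mem product-residue (*-closed (k mod n) m∈I)
    where
      product-residue : _*ₘ_ n (k mod n) (m mod n) ≡ (k * m) mod n
      product-residue = mod-cong n (begin
        (toℕ (k mod n) * toℕ (m mod n)) % n ≡⟨ cong₂ (λ i j → (i * j) % n) (toℕ-mod k n) (toℕ-mod m n) ⟩
        ((k % n) * (m % n)) % n             ≡⟨ %-distribˡ-* k m n ⟨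
        (k * m) % n                         ∎)

  gcd-mem : ∀ {x} → mem x → mem (gcd (toℕ x) n mod n)
  gcd-mem {x} x∈I with gcd-as-multiple (toℕ x) n
  ... | r , r*x≡g = subst mem (mod-cong n r*x≡g)
                      (scale-mem r (toℕ x) (subst mem (sym (toℕ-mod-cancel x)) x∈I))

  gcd-multiple-mem : ∀ {x t} → mem x → gcd (toℕ x) n ∣ t → mem (t mod n)
  gcd-multiple-mem {x} x∈I (divides c t≡c*g) =
    subst mem (cong (_mod n) (sym t≡c*g)) (scale-mem c _ (gcd-mem x∈I))

-- Lifting a difference from ℤ/M to ℤ/n, for M ∣ n.  For labels a, b < M,
-- `a + (M ∸ b)` represents a - b in ℤ/M and `a + (n ∸ b)` represents it
-- in ℤ/n.

module LiftDifference {n M : ℕ} .{{_ : NonZero n}} .{{_ : NonZero M}}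
                      (M∣n : M ∣ n) {a b : ℕ} (a<M : a < M) (b<M : b < M) where

  M≤n : M ≤ n
  M≤n = ∣⇒≤ M∣n

  lifted-difference : a + (n ∸ b) ≡ (a + (M ∸ b)) + (n ∸ M)
  lifted-difference = begin
    a + (n ∸ b)               ≡⟨ cong (λ k → a + (k ∸ b)) (m∸n+n≡m M≤n) ⟨
    a + ((n ∸ M) + M ∸ b)     ≡⟨ cong (a +_) (+-∸-assoc (n ∸ M) (<⇒≤ b<M)) ⟩
    a + ((n ∸ M) + (M ∸ b))   ≡⟨ cong (a +_) (+-comm (n ∸ M) (M ∸ b)) ⟩
    a + ((M ∸ b) + (n ∸ M))   ≡⟨ +-assoc a (M ∸ b) (n ∸ M) ⟨
    (a + (M ∸ b)) + (n ∸ M)   ∎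

  difference-zero : M ∣ a + (M ∸ b) → a ≡ b
  difference-zero M∣D = begin
    a                         ≡⟨ m<n⇒m%n≡m a<M ⟨
    a % M                     ≡⟨ [m+n]%n≡m%n a M ⟨
    (a + M) % M               ≡⟨ cong (λ k → (a + k) % M) (m∸n+n≡m (<⇒≤ b<M)) ⟨
    (a + ((M ∸ b) + b)) % M   ≡⟨ cong (_% M) (+-assoc a (M ∸ b) b) ⟨
    (a + (M ∸ b) + b) % M     ≡⟨ %-remove-+ˡ b M∣D ⟩
    b % M                     ≡⟨ m<n⇒m%n≡m b<M ⟩
    b                         ∎

  divisor-divides-lift : ∀ {x d} → x % M ≡ (a + (M ∸ b)) % M →
                         d ∣ x → d ∣ n → d ∣ M ⊎ M ∣ d → d ∣ a + (n ∸ b)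
  divisor-divides-lift {x} {d} x≡D d∣x d∣n (inj₁ d∣M) =
    subst (d ∣_) (sym lifted-difference) (∣m∣n⇒∣m+n d∣D d∣n∸M)
    where
      D = a + (M ∸ b)
      d∣D%M : d ∣ D % M
      d∣D%M = subst (d ∣_) x≡D (%-presˡ-∣ d∣x d∣M)
      d∣D : d ∣ D
      d∣D = subst (d ∣_) (sym (m≡m%n+[m/n]*n D M))
              (∣m∣n⇒∣m+n d∣D%M (∣-trans d∣M (n∣m*n (D / M))))
      d∣n∸M : d ∣ n ∸ M
      d∣n∸M = ∣m+n∣m⇒∣n (subst (d ∣_) (sym (m+[n∸m]≡n M≤n)) d∣n) d∣M
  divisor-divides-lift {x} {d} x≡D d∣x d∣n (inj₂ M∣d) =
    subst (λ c → d ∣ a + (n ∸ c)) a≡b (subst (d ∣_) (sym (m+[n∸m]≡n a≤n)) d∣n)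
    where
      M∣D : M ∣ a + (M ∸ b)
      M∣D = m%n≡0⇒n∣m _ M (trans (sym x≡D) (n∣m⇒m%n≡0 x M (∣-trans M∣d d∣x)))
      a≡b : a ≡ b
      a≡b = difference-zero M∣D
      a≤n : a ≤ n
      a≤n = ≤-trans (<⇒≤ a<M) M≤n

lift-edge : ∀ {n M} .{{_ : NonZero n}} .{{_ : NonZero M}} → M ∣ n →
            (∀ {d} → d ∣ n → d ∣ M ⊎ M ∣ d) →
            (I : Ideal n) (x : Fin n) → Ideal.mem I x →
            (y z : Fin M) → reduce M x ≡ _-ₘ_ M y z →
            (y′ z′ : Fin n) → toℕ y′ ≡ toℕ y → toℕ z′ ≡ toℕ z →
            Ideal.mem I (_-ₘ_ n y′ z′)
lift-edge {n} {M} M∣n comparable I x x∈I y z x≡y-z y′ z′ y′≡y z′≡z =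
  subst (Ideal.mem I) lift≡y′-z′
    (IdealMultiples.gcd-multiple-mem n I x∈I
      (divisor-divides-lift x%M≡y-z (gcd[m,n]∣m (toℕ x) n) (gcd[m,n]∣n (toℕ x) n)
        (comparable (gcd[m,n]∣n (toℕ x) n))))
  where
    open LiftDifference M∣n (toℕ<n y) (toℕ<n z)
    x%M≡y-z : toℕ x % M ≡ (toℕ y + (M ∸ toℕ z)) % M
    x%M≡y-z = trans (sym (toℕ-mod (toℕ x) M))
                (trans (cong toℕ x≡y-z) (toℕ-mod _ M))
    lift≡y′-z′ : (toℕ y + (n ∸ toℕ z)) mod n ≡ _-ₘ_ n y′ z′
    lift≡y′-z′ = cong₂ (λ s t → (s + (n ∸ t)) mod n) (sym y′≡y) (sym z′≡z)

lemma3p8 : (p : ℕ) (pr : Prime p) (ℓ : ℕ) → 1 ≤ ℓ →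
    (G : Graph) → Connected G →
    (α : Edge G → Ideal (p ^ ℓ) {{nz pr ℓ}}) →
    (β : ℕ) → 1 ≤ β → β ≤ ℓ →
    (P : Fin (verts G) → Fin (p ^ β)) →
    IsSpline G (p ^ β) {{nz pr β}} (imageLabel G (p ^ ℓ) (p ^ β) {{nz pr ℓ}} {{nz pr β}} α) P →
    (Pbar : Fin (verts G) → Fin (p ^ ℓ)) →
    (∀ v → toℕ (Pbar v) ≡ toℕ (P v)) →
    IsSpline G (p ^ ℓ) {{nz pr ℓ}} (λ e → Ideal.mem {{nz pr ℓ}} (α e)) Pbar
lemma3p8 p pr ℓ _ G _ α β _ β≤ℓ P P-spline Pbar same-rep e
  with P-spline e
... | x , x∈α , x≡difference =
  lift-edge p^β∣p^ℓ (prime-power-divisors-chain pr ℓ β) (α e) x x∈α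
    (P (src G e)) (P (tgt G e)) x≡difference
    (Pbar (src G e)) (Pbar (tgt G e)) (same-rep (src G e)) (same-rep (tgt G e))
  where
    instance
      p^ℓ≢0 : NonZero (p ^ ℓ)
      p^ℓ≢0 = nz pr ℓ
      p^β≢0 : NonZero (p ^ β)
      p^β≢0 = nz pr β
    p^β∣p^ℓ : p ^ β ∣ p ^ ℓ
    p^β∣p^ℓ = divides (p ^ (ℓ ∸ β)) (begin
      p ^ ℓ                   ≡⟨ cong (p ^_) (m+[n∸m]≡n β≤ℓ) ⟨
      p ^ (β + (ℓ ∸ β))       ≡⟨ ^-distribˡ-+-* p β (ℓ ∸ β) ⟩
      p ^ β * p ^ (ℓ ∸ β)     ≡⟨ *-comm (p ^ β) (p ^ (ℓ ∸ β)) ⟩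
      p ^ (ℓ ∸ β) * p ^ β     ∎)
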